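{- Let $p$ be a prime with $p\equiv 3\pmod 4$, $l\ge1$, $q=p^l$, and let $\xi=(\xi_1,\xi_2)\in\mathbb{Z}_q^2\setminus\{(0,0)\}$. If $\xi_1^2+\xi_2^2=0$ in $\mathbb{Z}_q$, then $|\mathrm{Stab}(\xi)|\leq p^{l-1}$, where $\mathrm{Stab}(\xi)=\{A\in SO_2(\mathbb{Z}_q): A\xi=\xi\}$.
   Context: $\mathbb{Z}_q$ is the ring of integers modulo $q$ and $SO_2(\mathbb{Z}_q)=\{A\in M_2(\mathbb{Z}_q): AA^T=I,\ \det(A)=1\}$, acting on $\mathbb{Z}_q^2$ by matrix multiplication. -}

module Defs where

open import Data.Nat using (ℕ; zero; suc; _∸_; NonZero)
import Data.Nat as ℕ
open import Data.Nat.DivMod using (_mod_)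
open import Data.Fin using (Fin; toℕ; fromℕ<)
import Data.Fin as Fin
open import Data.Fin.Properties using (_≟_)
open import Data.List using (List; filter; length; allFin; cartesianProductWith; map)
open import Data.Product using (_×_; _,_)
open import Relation.Binary.PropositionalEquality using (_≡_)
open import Relation.Nullary using (Dec)
open import Relation.Nullary.Decidable using (_×-dec_)

module ZMod (q : ℕ) .{{_ : NonZero q}} where

  Zq : Set
  Zq = Fin q

  infixl 6 _+q_ _-q_
  infixl 7 _*q_

  _+q_ : Zq → Zq → Zq
  x +q y = (toℕ x ℕ.+ toℕ y) mod q

  _*q_ : Zq → Zq → Zq
  x *q y = (toℕ x ℕ.* toℕ y) mod q

  -q_ : Zq → Zq
  -q x = (q ∸ toℕ x) mod q

  _-q_ : Zq → Zq → Zq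
  x -q y = x +q (-q y)

  0q : Zq
  0q = 0 mod q

  1q : Zq
  1q = 1 mod q

  -- 2×2 matrices  [[ a , b ] , [ c , d ]]  over ℤ_q
  record Mat : Set where
    constructor mat
    field
      a b c d : Zq
  open Mat public

  record Vec2 : Set where
    constructor vec
    field
      v₁ v₂ : Zq
  open Vec2 public

  _·_ : Mat → Mat → Mat
  mat a₁ b₁ c₁ d₁ · mat a₂ b₂ c₂ d₂ =
    mat (a₁ *q a₂ +q b₁ *q c₂) (a₁ *q b₂ +q b₁ *q d₂)
        (c₁ *q a₂ +q d₁ *q c₂) (c₁ *q b₂ +q d₁ *q d₂)

  transpose : Mat → Mat
  transpose (mat a b c d) = mat a c b d

  det : Mat → Zq
  det (mat a b c d) = a *q d -q b *q c

  I₂ : Mat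
  I₂ = mat 1q 0q 0q 1q

  _⊙_ : Mat → Vec2 → Vec2
  mat a b c d ⊙ vec x y = vec (a *q x +q b *q y) (c *q x +q d *q y)

  _≟M_ : (A B : Mat) → Dec (A ≡ B)
  mat a₁ b₁ c₁ d₁ ≟M mat a₂ b₂ c₂ d₂ = helper (a₁ ≟ a₂) (b₁ ≟ b₂) (c₁ ≟ c₂) (d₁ ≟ d₂)
    where
    open Relation.Nullary
    open import Relation.Binary.PropositionalEquality using (refl)
    helper : Dec (a₁ ≡ a₂) → Dec (b₁ ≡ b₂) → Dec (c₁ ≡ c₂) → Dec (d₁ ≡ d₂) →
             Dec (mat a₁ b₁ c₁ d₁ ≡ mat a₂ b₂ c₂ d₂)
    helper (yes refl) (yes refl) (yes refl) (yes refl) = yes refl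
    helper (no ¬p) _ _ _ = no λ { refl → ¬p refl }
    helper (yes _) (no ¬p) _ _ = no λ { refl → ¬p refl }
    helper (yes _) (yes _) (no ¬p) _ = no λ { refl → ¬p refl }
    helper (yes _) (yes _) (yes _) (no ¬p) = no λ { refl → ¬p refl }

  _≟V_ : (u w : Vec2) → Dec (u ≡ w)
  vec x₁ y₁ ≟V vec x₂ y₂ = helper (x₁ ≟ x₂) (y₁ ≟ y₂)
    where
    open Relation.Nullary
    open import Relation.Binary.PropositionalEquality using (refl)
    helper : Dec (x₁ ≡ x₂) → Dec (y₁ ≡ y₂) → Dec (vec x₁ y₁ ≡ vec x₂ y₂)
    helper (yes refl) (yes refl) = yes refl
    helper (no ¬p) _ = no λ { refl → ¬p refl }
    helper (yes _) (no ¬p) = no λ { refl → ¬p refl }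

  InSO₂ : Mat → Set
  InSO₂ A = (A · transpose A ≡ I₂) × (det A ≡ 1q)

  InSO₂? : (A : Mat) → Dec (InSO₂ A)
  InSO₂? A = ((A · transpose A) ≟M I₂) ×-dec (det A ≟ 1q)

  InStab : Vec2 → Mat → Set
  InStab ξ A = InSO₂ A × (A ⊙ ξ ≡ ξ)

  InStab? : (ξ : Vec2) → (A : Mat) → Dec (InStab ξ A)
  InStab? ξ A = InSO₂? A ×-dec ((A ⊙ ξ) ≟V ξ)

  -- list of all 2×2 matrices over ℤ_q (each exactly once)
  allPairs : List (Zq × Zq)
  allPairs = cartesianProductWith _,_ (allFin q) (allFin q)

  allMats : List Mat
  allMats = cartesianProductWith (λ { (a , b) (c , d) → mat a b c d }) allPairs allPairs

  Stab : Vec2 → List Mat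
  Stab ξ = filter (InStab? ξ) allMats

  ∣Stab∣ : Vec2 → ℕ
  ∣Stab∣ ξ = length (Stab ξ)

module Submission where

-- An element A of SO₂(ℤ_q) is a rotation [[a, b], [-b, a]] with a² + b² = 1.
-- If A fixes ξ ≠ 0, then N = (a - 1)² + b² = det (A - I) kills ξ, so p ∣ N
-- (otherwise N is a unit and ξ = 0).  Since -1 is not a square modulo a prime
-- p ≡ 3 (mod 4), this gives a ≡ 1 and b ≡ 0 (mod p).  Two such rotations with
-- the same b agree: q ∣ (a + a′)(a - a′) and a + a′ ≡ 2 is prime to p.  So
-- A ↦ b/p is injective on Stab(ξ) with values in [0, p^(l-1)), and
-- |Stab(ξ)| ≤ p^(l-1).  The bound holds for every ξ ≠ 0.

open import Defs
open import Data.Nat using (ℕ; NonZero; _%_)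
open import Data.Nat.Primality using (Prime)
open import Relation.Binary.PropositionalEquality using (_≡_)

module BinomialsModPrime where

  open import Data.Nat
  open import Data.Nat.Properties
  open import Data.Nat.Divisibility
  open import Data.Nat.Primality
  open import Data.Nat.Combinatorics
  open import Data.Nat.DivMod using (m/n*n≡m)
  open import Data.Nat.Tactic.RingSolver using (solve-∀)
  open import Data.Product using (∃; _,_)
  open import Data.Sum using (inj₁; inj₂)
  open import Relation.Nullary using (¬_; contradiction)
  open import Relation.Binary.PropositionalEquality

  prime>1 : ∀ {p} → Prime p → 1 < p
  prime>1 {p} pr = nonTrivial⇒n>1 p {{prime⇒nonTrivial pr}}

  prime∤factorial : ∀ {p} → Prime p → ∀ m → m < p → ¬ p ∣ m !
  prime∤factorial pr zero    _   p∣1 = >⇒∤ (prime>1 pr) p∣1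
  prime∤factorial pr (suc m) m<p p∣m! with euclidsLemma (suc m) (m !) pr p∣m!
  ... | inj₁ p∣1+m = <⇒≱ m<p (∣⇒≤ p∣1+m)
  ... | inj₂ p∣m!′ = prime∤factorial pr m (<-trans (n<1+n m) m<p) p∣m!′

  -- p divides C(p,k) for 0 < k < p: C(p,k)·k!·(p-k)! = p! is divisible by p,
  -- but neither k! nor (p-k)! is.
  prime∣binomial : ∀ {p k} → Prime p → 0 < k → k < p → p ∣ p C k
  prime∣binomial {p@(suc p-1)} {k} pr 0<k k<p
    with euclidsLemma (p C k) (k ! * (p ∸ k) !) pr p∣product
    where
    instance
      k![p-k]!≢0 : NonZero (k ! * (p ∸ k) !)
      k![p-k]!≢0 = k !* (p ∸ k) !≢0
    product≡p! : (p C k) * (k ! * (p ∸ k) !) ≡ p !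
    product≡p! = begin
      (p C k) * (k ! * (p ∸ k) !)                 ≡⟨ cong (_* (k ! * (p ∸ k) !)) (nCk≡n!/k![n-k]! (<⇒≤ k<p)) ⟩
      (p ! / (k ! * (p ∸ k) !)) * (k ! * (p ∸ k) !) ≡⟨ m/n*n≡m (k![n∸k]!∣n! (<⇒≤ k<p)) ⟩
      p !                                          ∎
      where open ≡-Reasoning
    p∣product : p ∣ (p C k) * (k ! * (p ∸ k) !)
    p∣product = subst (p ∣_) (sym product≡p!) (m∣m*n (p-1 !))
  ... | inj₁ p∣pCk = p∣pCk
  ... | inj₂ p∣factorials with euclidsLemma (k !) ((p ∸ k) !) pr p∣factorials
  ...   | inj₁ p∣k!     = contradiction p∣k! (prime∤factorial pr k k<p)
  ...   | inj₂ p∣[p-k]! = contradiction p∣[p-k]! (prime∤factorial pr (p ∸ k) (∸-monoʳ-< 0<k (<⇒≤ k<p)))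

  binomialSum : ℕ → ℕ → ℕ → ℕ
  binomialSum n zero    x = 0
  binomialSum n (suc m) x = binomialSum n m x + (n C m) * x ^ m

  binomialSum-pascal : ∀ n m x →
    binomialSum (suc n) (suc m) x ≡ binomialSum n (suc m) x + x * binomialSum n m x
  binomialSum-pascal n zero x = cong suc (sym (*-zeroʳ x))
  binomialSum-pascal n (suc m) x = begin
    S′ (suc m) + (suc n C suc m) * (x * x ^ m)
      ≡⟨ cong₂ _+_ (binomialSum-pascal n m x) (cong (_* (x * x ^ m)) (sym (nCk+nC[k+1]≡[n+1]C[k+1] n m))) ⟩
    (S (suc m) + x * S m) + ((n C m) + (n C suc m)) * (x * x ^ m)
      ≡⟨ regroup (S (suc m)) (S m) (n C m) (n C suc m) x (x ^ m) ⟩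
    (S (suc m) + (n C suc m) * (x * x ^ m)) + x * (S m + (n C m) * x ^ m) ∎
    where
    open ≡-Reasoning
    S S′ : ℕ → ℕ
    S  j = binomialSum n j x
    S′ j = binomialSum (suc n) j x
    regroup : ∀ s t c c′ x y → (s + x * t) + (c + c′) * (x * y) ≡ (s + c′ * (x * y)) + x * (t + c * y)
    regroup = solve-∀

  binomial-theorem : ∀ n x → suc x ^ n ≡ binomialSum n (suc n) x
  binomial-theorem zero    x = refl
  binomial-theorem (suc n) x = begin
    suc x * suc x ^ n                     ≡⟨ cong (suc x *_) (binomial-theorem n x) ⟩
    suc x * S                             ≡⟨ expand S x ⟩
    (S + 0) + x * S                       ≡⟨ cong (λ t → (S + t) + x * S) (sym top-term≡0) ⟩
    (S + (n C suc n) * x ^ suc n) + x * S ≡⟨ sym (binomialSum-pascal n (suc n) x) ⟩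
    binomialSum (suc n) (suc (suc n)) x   ∎
    where
    open ≡-Reasoning
    S : ℕ
    S = binomialSum n (suc n) x
    expand : ∀ s x → suc x * s ≡ (s + 0) + x * s
    expand = solve-∀
    top-term≡0 : (n C suc n) * x ^ suc n ≡ 0
    top-term≡0 = cong (_* x ^ suc n) (k>n⇒nCk≡0 (n<1+n n))

  -- Modulo a prime p, every partial sum Σ_{k ≤ m} C(p,k) x^k with m < p is 1,
  -- since all its terms except the first are divisible by p.
  binomialSum-prime : ∀ {p} → Prime p → ∀ x m → m < p → ∃ λ k → binomialSum p (suc m) x ≡ 1 + k * p
  binomialSum-prime pr x zero    _    = 0 , refl
  binomialSum-prime {p} pr x (suc m) 1+m<p
    with binomialSum-prime pr x m (<-trans (n<1+n m) 1+m<p) | prime∣binomial pr (s≤s z≤n) 1+m<p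
  ... | k , sum≡ | divides j pCk≡ = k + j * x ^ suc m , (begin
    binomialSum p (suc m) x + (p C suc m) * x ^ suc m ≡⟨ cong₂ _+_ sum≡ (cong (_* x ^ suc m) pCk≡) ⟩
    (1 + k * p) + (j * p) * x ^ suc m                 ≡⟨ collect k p j (x ^ suc m) ⟩
    1 + (k + j * x ^ suc m) * p                       ∎)
    where
    open ≡-Reasoning
    collect : ∀ k p j y → (1 + k * p) + (j * p) * y ≡ 1 + (k + j * y) * p
    collect = solve-∀

  -- Fermat's little theorem over ℕ: x^p ≡ x (mod p), by induction on x,
  -- using (1 + x)^p ≡ 1 + x^p (mod p).
  fermat-ℕ : ∀ {p} → Prime p → ∀ x → ∃ λ k → x ^ p ≡ x + k * p
  fermat-ℕ {suc p-1} pr zero = 0 , refl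
  fermat-ℕ {p@(suc p-1)} pr (suc x) with fermat-ℕ pr x | binomialSum-prime pr x p-1 (n<1+n p-1)
  ... | k , x^p≡ | j , sum≡ = k + j , (begin
    suc x ^ p                           ≡⟨ binomial-theorem p x ⟩
    binomialSum p p x + (p C p) * x ^ p ≡⟨ cong₂ _+_ sum≡ (cong₂ _*_ (nCn≡1 p) x^p≡) ⟩
    (1 + j * p) + 1 * (x + k * p)       ≡⟨ collect j p x k ⟩
    suc x + (k + j) * p                 ∎)
    where
    open ≡-Reasoning
    collect : ∀ j p x k → (1 + j * p) + 1 * (x + k * p) ≡ suc x + (k + j) * p
    collect = solve-∀

module Congruences where

  open import Data.Nat as ℕ using (ℕ; zero; suc)
  import Data.Nat.Properties as ℕ
  import Data.Nat.Divisibility as ℕD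
  open import Data.Nat.DivMod using (m≡m%n+[m/n]*n)
  open import Data.Nat.Primality using (Prime; prime⇒nonZero; euclidsLemma)
  open import Data.Nat.Tactic.RingSolver using () renaming (solve-∀ to ℕ-solve-∀)
  open import Data.Integer hiding (suc)
  open import Data.Integer.Properties
  open import Data.Integer.Divisibility.Signed
  open import Data.Integer.DivMod using (a≡a%ℕn+[a/ℕn]*n)
  open import Data.Integer.Tactic.RingSolver using (solve; solve-∀)
  open import Data.List using (_∷_; [])
  open import Data.Product using (proj₁; proj₂)
  open import Data.Sum as Sum using (_⊎_; inj₁; inj₂)
  open import Function using (id)
  open import Level using (0ℓ)
  open import Relation.Nullary using (¬_; contradiction; yes; no)
  open import Relation.Binary.Bundles using (Setoid)
  import Relation.Binary.Reasoning.Setoid as SetoidReasoning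
  open import Relation.Binary.PropositionalEquality
  open BinomialsModPrime using (fermat-ℕ)

  infix 4 _≈_mod_
  record _≈_mod_ (a b : ℤ) (n : ℕ) : Set where
    constructor congruent
    field difference : + n ∣ a - b
  open _≈_mod_ public

  -- Transport divisibility along an equation of dividends; used with the ring
  -- solver to certify that an expression is a known combination of multiples.
  divides-≡ : ∀ {k s t} → k ∣ s → s ≡ t → k ∣ t
  divides-≡ k∣s refl = k∣s

  module _ {n : ℕ} where

    divisible⇒≡0 : ∀ {a} → + n ∣ a → a ≈ 0ℤ mod n
    divisible⇒≡0 {a} n∣a = congruent (subst (+ n ∣_) (sym (+-identityʳ a)) n∣a)

    ≡0⇒divisible : ∀ {a} → a ≈ 0ℤ mod n → + n ∣ a
    ≡0⇒divisible {a} (congruent n∣a-0) = subst (+ n ∣_) (+-identityʳ a) n∣a-0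

    mod-refl : ∀ {a} → a ≈ a mod n
    mod-refl {a} = congruent (subst (+ n ∣_) (sym (+-inverseʳ a)) (divides 0ℤ refl))

    mod-sym : ∀ {a b} → a ≈ b mod n → b ≈ a mod n
    mod-sym {a} {b} (congruent d) = congruent (divides-≡ (∣m⇒∣-m d) (solve (a ∷ b ∷ [])))

    mod-trans : ∀ {a b c} → a ≈ b mod n → b ≈ c mod n → a ≈ c mod n
    mod-trans {a} {b} {c} (congruent d) (congruent e) =
      congruent (divides-≡ (∣m∣n⇒∣m+n d e) (solve (a ∷ b ∷ c ∷ [])))

    mod-+ : ∀ {a a′ b b′} → a ≈ a′ mod n → b ≈ b′ mod n → a + b ≈ a′ + b′ mod n
    mod-+ {a} {a′} {b} {b′} (congruent d) (congruent e) =
      congruent (divides-≡ (∣m∣n⇒∣m+n d e) (solve (a ∷ a′ ∷ b ∷ b′ ∷ [])))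

    mod-* : ∀ {a a′ b b′} → a ≈ a′ mod n → b ≈ b′ mod n → a * b ≈ a′ * b′ mod n
    mod-* {a} {a′} {b} {b′} (congruent d) (congruent e) =
      congruent (divides-≡ (∣m∣n⇒∣m+n (∣n⇒∣m*n b d) (∣n⇒∣m*n a′ e)) (solve (a ∷ a′ ∷ b ∷ b′ ∷ [])))

    mod-neg : ∀ {a a′} → a ≈ a′ mod n → - a ≈ - a′ mod n
    mod-neg {a} {a′} (congruent d) = congruent (divides-≡ (∣m⇒∣-m d) (solve (a ∷ a′ ∷ [])))

    mod-^ : ∀ {a a′} → a ≈ a′ mod n → ∀ k → a ^ k ≈ a′ ^ k mod n
    mod-^ a≡a′ zero    = mod-refl
    mod-^ a≡a′ (suc k) = mod-* a≡a′ (mod-^ a≡a′ k)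

    mod-+multiple : ∀ a k → a + k * + n ≈ a mod n
    mod-+multiple a k = congruent (divides k (cancel a (k * + n)))
      where
      cancel : ∀ a m → a + m - a ≡ m
      cancel = solve-∀

  mod-setoid : ℕ → Setoid 0ℓ 0ℓ
  mod-setoid n = record
    { Carrier = ℤ
    ; _≈_ = λ a b → a ≈ b mod n
    ; isEquivalence = record { refl = mod-refl ; sym = mod-sym ; trans = mod-trans }
    }

  pos-^ : ∀ m k → + (m ℕ.^ k) ≡ (+ m) ^ k
  pos-^ m zero    = refl
  pos-^ m (suc k) = trans (pos-* m (m ℕ.^ k)) (cong (+ m *_) (pos-^ m k))

  odd-power : ∀ v e → v ^ suc (2 ℕ.* e) ≡ v * (v * v) ^ e
  odd-power v e = cong (v *_) (begin
    v ^ (2 ℕ.* e)       ≡⟨ ^-*-assoc v 2 e ⟨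
    (v * (v * 1ℤ)) ^ e  ≡⟨ cong (λ w → (v * w) ^ e) (*-identityʳ v) ⟩
    (v * v) ^ e         ∎)
    where open ≡-Reasoning

  odd-power-neg : ∀ t e → (- t) ^ suc (2 ℕ.* e) ≡ - (t ^ suc (2 ℕ.* e))
  odd-power-neg t e = begin
    (- t) ^ suc (2 ℕ.* e)          ≡⟨ odd-power (- t) e ⟩
    - t * ((- t) * (- t)) ^ e      ≡⟨ cong (λ w → - t * w ^ e) (neg-square t) ⟩
    - t * (t * t) ^ e              ≡⟨ neg-distribˡ-* t ((t * t) ^ e) ⟨
    - (t * (t * t) ^ e)            ≡⟨ cong -_ (odd-power t e) ⟨
    - (t ^ suc (2 ℕ.* e))          ∎
    where
    open ≡-Reasoning
    neg-square : ∀ t → (- t) * (- t) ≡ t * t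
    neg-square = solve-∀

  euclid-ℤ : ∀ {p} → Prime p → ∀ s t → + p ∣ s * t → (+ p ∣ s) ⊎ (+ p ∣ t)
  euclid-ℤ {p} pr s t p∣st =
    Sum.map ∣ᵤ⇒∣ ∣ᵤ⇒∣ (euclidsLemma ∣ s ∣ ∣ t ∣ pr (subst (p ℕD.∣_) (abs-* s t) (∣⇒∣ᵤ p∣st)))

  -- Fermat's little theorem over ℤ: reduce u to its residue r ∈ [0, p) and
  -- apply the version over ℕ.
  fermat-ℤ : ∀ {p} → Prime p → ∀ u → u ^ p ≈ u mod p
  fermat-ℤ {p} pr u = begin
    u ^ p                      ≈⟨ mod-^ u≈r p ⟩
    (+ r) ^ p                  ≡⟨ pos-^ r p ⟨
    + (r ℕ.^ p)                ≡⟨ cong +_ (proj₂ (fermat-ℕ pr r)) ⟩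
    + (r ℕ.+ k ℕ.* p)          ≡⟨ trans (pos-+ r (k ℕ.* p)) (cong (_+_ (+ r)) (pos-* k p)) ⟩
    + r + + k * + p            ≈⟨ mod-+multiple (+ r) (+ k) ⟩
    + r                        ≈⟨ mod-sym u≈r ⟩
    u                          ∎
    where
    instance
      p≢0 : ℕ.NonZero p
      p≢0 = prime⇒nonZero pr
    open SetoidReasoning (mod-setoid p)
    r k : ℕ
    r = u %ℕ p
    k = proj₁ (fermat-ℕ pr r)
    u≈r : u ≈ + r mod p
    u≈r = subst (_≈ + r mod p) (sym (a≡a%ℕn+[a/ℕn]*n u p)) (mod-+multiple (+ r) (u /ℕ p))

  -- For an odd prime p = 1 + 2e and p ∤ v we have (v²)^e ≡ 1 (mod p):
  -- by Fermat p ∣ v^p - v = v · ((v²)^e - 1), and p ∤ v.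
  half-power-of-square : ∀ {p} → Prime p → ∀ e → p ≡ suc (2 ℕ.* e) →
                         ∀ v → ¬ + p ∣ v → (v * v) ^ e ≈ 1ℤ mod p
  half-power-of-square {p} pr e p≡1+2e v p∤v =
    Sum.[ (λ p∣v → contradiction p∣v p∤v) , congruent ]′ (euclid-ℤ pr v ((v * v) ^ e - 1ℤ) p∣v[vv^e-1])
    where
    factor : ∀ v w → v * w - v ≡ v * (w - 1ℤ)
    factor = solve-∀
    v^p≡ : v ^ p ≡ v * (v * v) ^ e
    v^p≡ = trans (cong (v ^_) p≡1+2e) (odd-power v e)
    p∣v[vv^e-1] : + p ∣ v * ((v * v) ^ e - 1ℤ)
    p∣v[vv^e-1] = divides-≡ (difference (fermat-ℤ pr v)) (trans (cong (_- v) v^p≡) (factor v ((v * v) ^ e)))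

  three-mod-four : ∀ p → p ℕ.% 4 ≡ 3 → p ≡ suc (2 ℕ.* suc (2 ℕ.* (p ℕ./ 4)))
  three-mod-four p p%4≡3 = begin
    p                          ≡⟨ m≡m%n+[m/n]*n p 4 ⟩
    p ℕ.% 4 ℕ.+ (p ℕ./ 4) ℕ.* 4 ≡⟨ cong (ℕ._+ (p ℕ./ 4) ℕ.* 4) p%4≡3 ⟩
    3 ℕ.+ (p ℕ./ 4) ℕ.* 4       ≡⟨ regroup (p ℕ./ 4) ⟩
    suc (2 ℕ.* suc (2 ℕ.* (p ℕ./ 4))) ∎
    where
    open ≡-Reasoning
    regroup : ∀ m → 3 ℕ.+ m ℕ.* 4 ≡ suc (2 ℕ.* suc (2 ℕ.* m))
    regroup = ℕ-solve-∀

  three-mod-four-∤2 : ∀ {p} → p ℕ.% 4 ≡ 3 → ¬ + p ∣ + 2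
  three-mod-four-∤2 {p} p%4≡3 p∣2 = ℕ.<⇒≱ 2<p (ℕD.∣⇒≤ (∣⇒∣ᵤ p∣2))
    where
    2<p : 2 ℕ.< p
    2<p = subst (2 ℕ.<_) (sym (three-mod-four p p%4≡3)) (ℕ.s≤s (ℕ.*-monoʳ-≤ 2 (ℕ.s≤s ℕ.z≤n)))

  -- For a prime p ≡ 3 (mod 4), -1 is not a square modulo p, so p ∣ u² + b²
  -- forces p ∣ u.  If p ∤ b this is the contradiction 1 ≡ (u²)^e ≡ (-b²)^e ≡ -1
  -- with p = 1 + 2e, e odd; if p ∣ b then p ∣ u² directly.
  sum-of-two-squares : ∀ {p} → Prime p → p ℕ.% 4 ≡ 3 →
                       ∀ u b → + p ∣ u * u + b * b → + p ∣ u
  sum-of-two-squares {p} pr p%4≡3 u b p∣u²+b² with + p ∣? u | + p ∣? b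
  ... | yes p∣u | _       = p∣u
  ... | no _    | yes p∣b = Sum.[ id , id ]′ (euclid-ℤ pr u u (∣m+n∣n⇒∣m p∣u²+b² (∣n⇒∣m*n b p∣b)))
  ... | no p∤u  | no p∤b  = contradiction (difference 1≈-1) (three-mod-four-∤2 p%4≡3)
    where
    m e : ℕ
    m = p ℕ./ 4
    e = suc (2 ℕ.* m)
    p≡1+2e : p ≡ suc (2 ℕ.* e)
    p≡1+2e = three-mod-four p p%4≡3
    u²≈-b² : u * u ≈ - (b * b) mod p
    u²≈-b² = congruent (divides-≡ p∣u²+b² (as-difference u b))
      where
      as-difference : ∀ u b → u * u + b * b ≡ u * u - - (b * b)
      as-difference = solve-∀
    1≈-1 : 1ℤ ≈ -1ℤ mod p
    1≈-1 = begin
      1ℤ              ≈⟨ half-power-of-square pr e p≡1+2e u p∤u ⟨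
      (u * u) ^ e     ≈⟨ mod-^ u²≈-b² e ⟩
      (- (b * b)) ^ e ≡⟨ odd-power-neg (b * b) m ⟩
      - ((b * b) ^ e) ≈⟨ mod-neg (half-power-of-square pr e p≡1+2e b p∤b) ⟩
      - 1ℤ            ∎
      where open SetoidReasoning (mod-setoid p)

  -- If p ∤ s then p^l ∣ s·t forces p^l ∣ t: peel off one factor p at a time
  -- with Euclid's lemma.
  prime-power-cancel : ∀ {p} → Prime p → ∀ {s} → ¬ + p ∣ s →
                       ∀ l {t} → + (p ℕ.^ l) ∣ s * t → + (p ℕ.^ l) ∣ t
  prime-power-cancel {p} pr {s} p∤s l {t} d =
    ∣ᵤ⇒∣ (cancelℕ l ∣ t ∣ (subst (p ℕ.^ l ℕD.∣_) (abs-* s t) (∣⇒∣ᵤ d)))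
    where
    instance
      p≢0 : ℕ.NonZero p
      p≢0 = prime⇒nonZero pr
    p∤∣s∣ : ¬ p ℕD.∣ ∣ s ∣
    p∤∣s∣ p∣s = p∤s (∣ᵤ⇒∣ p∣s)
    cancelℕ : ∀ l m → p ℕ.^ l ℕD.∣ ∣ s ∣ ℕ.* m → p ℕ.^ l ℕD.∣ m
    cancelℕ zero    m _ = ℕD.1∣ m
    cancelℕ (suc l) m d with euclidsLemma ∣ s ∣ m pr (ℕD.m*n∣⇒m∣ p (p ℕ.^ l) d)
    ... | inj₁ p∣s = contradiction p∣s p∤∣s∣
    ... | inj₂ (ℕD.divides j refl) =
      subst (p ℕ.^ suc l ℕD.∣_) (ℕ.*-comm p j) (ℕD.*-monoʳ-∣ p (cancelℕ l j (ℕD.*-cancelˡ-∣ p d′)))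
      where
      rotate : ∀ a j p → a ℕ.* (j ℕ.* p) ≡ p ℕ.* (a ℕ.* j)
      rotate = ℕ-solve-∀
      d′ : p ℕ.* p ℕ.^ l ℕD.∣ p ℕ.* (∣ s ∣ ℕ.* j)
      d′ = subst (p ℕ.^ suc l ℕD.∣_) (rotate ∣ s ∣ j p) d

module Rotations where

  open import Data.Nat using (ℕ)
  open import Data.Integer using (ℤ; +_; _+_; _-_; _*_; -_; 0ℤ; 1ℤ)
  open import Data.Integer.Divisibility.Signed using (_∣_; ∣m∣n⇒∣m+n; ∣n⇒∣m*n)
  open import Data.Integer.Tactic.RingSolver using (solve)
  open import Data.List using (_∷_; [])
  open import Data.Product using (_×_; _,_)
  open Congruences

  -- u · (a - a′) is a multiple of n whenever a ≡ a′ (mod n); sums of such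
  -- terms certify congruences via explicit ring identities.
  scaled-difference : ∀ {n a a′} (u : ℤ) → a ≈ a′ mod n → + n ∣ u * (a - a′)
  scaled-difference u a≈a′ = ∣n⇒∣m*n u (difference a≈a′)

  -- Orthonormal rows and determinant 1 force [[a, b], [c, d]] to be a rotation
  -- [[a, b], [-b, a]]: e.g. c = c(ad - bc) = d(ac + bd) - b(c² + d²) ≡ -b.
  rotation-shape : ∀ {n} a b c d →
    a * c + b * d ≈ 0ℤ mod n → c * c + d * d ≈ 1ℤ mod n → a * d - b * c ≈ 1ℤ mod n →
    c ≈ - b mod n × d ≈ a mod n
  rotation-shape a b c d orth row₂ unimodular =
    congruent (divides-≡
      (∣m∣n⇒∣m+n (∣m∣n⇒∣m+n (scaled-difference (- c) unimodular) (scaled-difference d orth))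
                 (scaled-difference (- b) row₂))
      (solve (a ∷ b ∷ c ∷ d ∷ []))) ,
    congruent (divides-≡
      (∣m∣n⇒∣m+n (∣m∣n⇒∣m+n (scaled-difference (- d) unimodular) (scaled-difference a row₂))
                 (scaled-difference (- c) orth))
      (solve (a ∷ b ∷ c ∷ d ∷ [])))

  record FixingRotation (n : ℕ) (a b c d x y : ℤ) : Set where
    field
      c≈-b : c ≈ - b mod n
      d≈a  : d ≈ a mod n
      norm : a * a + b * b ≈ 1ℤ mod n
      fix₁ : a * x + b * y ≈ x mod n
      fix₂ : - b * x + a * y ≈ y mod n

  -- A rotation fixing (x, y) satisfies N·x ≡ N·y ≡ 0 with N = (a - 1)² + b²:
  -- the fixed-point equations say (A - I)(x, y) ≡ 0, and N = det (A - I).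
  rotation-fixed-vector : ∀ {n a b c d x y} → FixingRotation n a b c d x y →
    ((a - 1ℤ) * (a - 1ℤ) + b * b) * x ≈ 0ℤ mod n ×
    ((a - 1ℤ) * (a - 1ℤ) + b * b) * y ≈ 0ℤ mod n
  rotation-fixed-vector {a = a} {b = b} {x = x} {y = y} R =
    congruent (divides-≡
      (∣m∣n⇒∣m+n (scaled-difference (a - 1ℤ) fix₁) (scaled-difference (- b) fix₂))
      (solve (a ∷ b ∷ x ∷ y ∷ []))) ,
    congruent (divides-≡
      (∣m∣n⇒∣m+n (scaled-difference b fix₁) (scaled-difference (a - 1ℤ) fix₂))
      (solve (a ∷ b ∷ x ∷ y ∷ [])))
    where open FixingRotation R

module Residues (q : ℕ) .{{_ : NonZero q}} where

  import Data.Nat as ℕ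
  import Data.Nat.Properties as ℕ
  import Data.Nat.Divisibility as ℕD
  open import Data.Nat.DivMod using (_mod_; m≡m%n+[m/n]*n; m<n⇒m%n≡m; %-remove-+ʳ)
  open import Data.Fin using (toℕ)
  open import Data.Fin.Properties using (toℕ<n; toℕ-fromℕ<; toℕ-injective)
  open import Data.Integer hiding (suc; NonZero)
  open import Data.Integer.Properties
  open import Data.Integer.Divisibility.Signed using (_∣_; ∣⇒∣ᵤ)
  open import Data.List.Relation.Unary.All using (All)
  import Data.List.Relation.Unary.All.Properties as All
  open import Data.List.Relation.Unary.Unique.Propositional using (Unique)
  import Data.List.Relation.Unary.Unique.Propositional.Properties as Unique
  open import Data.Product using (_×_; _,_; proj₁; proj₂)
  open import Data.Sum using (inj₁; inj₂)
  import Relation.Binary.Reasoning.Setoid as SetoidReasoning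
  open import Relation.Binary.PropositionalEquality
  open Congruences
  open Rotations
  open ZMod q

  ι : Zq → ℤ
  ι x = + toℕ x

  ι-mod : ∀ n → ι (n mod q) ≈ + n mod q
  ι-mod n = begin
    ι (n mod q)                          ≡⟨ cong +_ (toℕ-fromℕ< _) ⟩
    + (n ℕ.% q)                          ≈⟨ mod-+multiple (+ (n ℕ.% q)) (+ (n ℕ./ q)) ⟨
    + (n ℕ.% q) + + (n ℕ./ q) * + q      ≡⟨ cong (_+_ (+ (n ℕ.% q))) (pos-* (n ℕ./ q) q) ⟨
    + (n ℕ.% q) + + (n ℕ./ q ℕ.* q)      ≡⟨ pos-+ (n ℕ.% q) _ ⟨
    + (n ℕ.% q ℕ.+ n ℕ./ q ℕ.* q)        ≡⟨ cong +_ (m≡m%n+[m/n]*n n q) ⟨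
    + n                                  ∎
    where open SetoidReasoning (mod-setoid q)

  ι-+ : ∀ x y → ι (x +q y) ≈ ι x + ι y mod q
  ι-+ x y = subst (ι (x +q y) ≈_mod q) (pos-+ (toℕ x) (toℕ y)) (ι-mod (toℕ x ℕ.+ toℕ y))

  ι-* : ∀ x y → ι (x *q y) ≈ ι x * ι y mod q
  ι-* x y = subst (ι (x *q y) ≈_mod q) (pos-* (toℕ x) (toℕ y)) (ι-mod (toℕ x ℕ.* toℕ y))

  ι-neg : ∀ x → ι (-q x) ≈ - ι x mod q
  ι-neg x = begin
    ι (-q x)            ≈⟨ ι-mod (q ℕ.∸ toℕ x) ⟩
    + (q ℕ.∸ toℕ x)     ≡⟨ ⊖-≥ (ℕ.<⇒≤ (toℕ<n x)) ⟨
    q ⊖ toℕ x           ≡⟨ m-n≡m⊖n q (toℕ x) ⟨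
    + q - ι x           ≡⟨ +-comm (+ q) (- ι x) ⟩
    - ι x + + q         ≡⟨ cong (_+_ (- ι x)) (*-identityˡ (+ q)) ⟨
    - ι x + 1ℤ * + q    ≈⟨ mod-+multiple (- ι x) 1ℤ ⟩
    - ι x               ∎
    where open SetoidReasoning (mod-setoid q)

  -- Two numbers m ≤ n < q that are congruent modulo q are equal, since
  -- q ∣ n - m and both are their own remainders.
  congruent-below-modulus : ∀ {m n} → m ℕ.≤ n → n ℕ.< q → + n ≈ + m mod q → m ≡ n
  congruent-below-modulus {m} {n} m≤n n<q n≈m = begin
    m                         ≡⟨ m<n⇒m%n≡m (ℕ.≤-<-trans m≤n n<q) ⟨
    m ℕ.% q                   ≡⟨ %-remove-+ʳ m q∣n∸m ⟨
    (m ℕ.+ (n ℕ.∸ m)) ℕ.% q   ≡⟨ cong (ℕ._% q) (ℕ.m+[n∸m]≡n m≤n) ⟩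
    n ℕ.% q                   ≡⟨ m<n⇒m%n≡m n<q ⟩
    n                         ∎
    where
    open ≡-Reasoning
    ∣n-m∣≡n∸m : ∣ + n - + m ∣ ≡ n ℕ.∸ m
    ∣n-m∣≡n∸m = trans (cong ∣_∣ ([+m]-[+n]≡m⊖n n m)) (trans (∣m⊖n∣≡∣n⊖m∣ n m) (∣⊖∣-≤ m≤n))
    q∣n∸m : q ℕD.∣ n ℕ.∸ m
    q∣n∸m = subst (q ℕD.∣_) ∣n-m∣≡n∸m (∣⇒∣ᵤ (difference n≈m))

  ι-injective : ∀ {x y} → ι x ≈ ι y mod q → x ≡ y
  ι-injective {x} {y} x≈y with ℕ.≤-total (toℕ x) (toℕ y)
  ... | inj₁ x≤y = toℕ-injective (congruent-below-modulus x≤y (toℕ<n y) (mod-sym x≈y))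
  ... | inj₂ y≤x = toℕ-injective (sym (congruent-below-modulus y≤x (toℕ<n x) x≈y))

  -- The entries of products of 2×2 matrices and of matrix–vector products
  -- have the shape w·x + y·z; determinants have the shape w·x - y·z.
  ι-sum-of-products : ∀ w x y z → ι (w *q x +q y *q z) ≈ ι w * ι x + ι y * ι z mod q
  ι-sum-of-products w x y z = begin
    ι (w *q x +q y *q z)      ≈⟨ ι-+ (w *q x) (y *q z) ⟩
    ι (w *q x) + ι (y *q z)   ≈⟨ mod-+ (ι-* w x) (ι-* y z) ⟩
    ι w * ι x + ι y * ι z     ∎
    where open SetoidReasoning (mod-setoid q)

  ι-difference-of-products : ∀ w x y z → ι (w *q x -q y *q z) ≈ ι w * ι x - ι y * ι z mod q
  ι-difference-of-products w x y z = begin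
    ι (w *q x -q y *q z)        ≈⟨ ι-+ (w *q x) (-q (y *q z)) ⟩
    ι (w *q x) + ι (-q (y *q z)) ≈⟨ mod-+ (ι-* w x) (mod-trans (ι-neg (y *q z)) (mod-neg (ι-* y z))) ⟩
    ι w * ι x - ι y * ι z       ∎
    where open SetoidReasoning (mod-setoid q)

  transfer : ∀ {x y X Y} → x ≡ y → ι x ≈ X mod q → ι y ≈ Y mod q → X ≈ Y mod q
  transfer refl x≈X y≈Y = mod-trans (mod-sym x≈X) y≈Y

  ι-zero : ∀ {z} → + q ∣ ι z → z ≡ 0q
  ι-zero q∣z = ι-injective (mod-trans (divisible⇒≡0 q∣z) (mod-sym (ι-mod 0)))

  stabiliser-rotation : ∀ {a b c d x y} → InStab (vec x y) (mat a b c d) →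
                        FixingRotation q (ι a) (ι b) (ι c) (ι d) (ι x) (ι y)
  stabiliser-rotation {a} {b} {c} {d} {x} {y} ((AAᵀ≡I , det≡1) , Aξ≡ξ) = record
    { c≈-b = proj₁ shape ; d≈a = proj₂ shape ; norm = row₁ ; fix₁ = fix₁ ; fix₂ = fix₂ }
    where
    row₁ : ι a * ι a + ι b * ι b ≈ 1ℤ mod q
    row₁ = transfer (cong Mat.a AAᵀ≡I) (ι-sum-of-products a a b b) (ι-mod 1)
    orth : ι a * ι c + ι b * ι d ≈ 0ℤ mod q
    orth = transfer (cong Mat.b AAᵀ≡I) (ι-sum-of-products a c b d) (ι-mod 0)
    row₂ : ι c * ι c + ι d * ι d ≈ 1ℤ mod q
    row₂ = transfer (cong Mat.d AAᵀ≡I) (ι-sum-of-products c c d d) (ι-mod 1)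
    unimodular : ι a * ι d - ι b * ι c ≈ 1ℤ mod q
    unimodular = transfer det≡1 (ι-difference-of-products a d b c) (ι-mod 1)
    shape : ι c ≈ - ι b mod q × ι d ≈ ι a mod q
    shape = rotation-shape (ι a) (ι b) (ι c) (ι d) orth row₂ unimodular
    fix₁ : ι a * ι x + ι b * ι y ≈ ι x mod q
    fix₁ = transfer (cong v₁ Aξ≡ξ) (ι-sum-of-products a x b y) mod-refl
    fix₂ : - ι b * ι x + ι a * ι y ≈ ι y mod q
    fix₂ = mod-trans (mod-+ (mod-* (mod-sym (proj₁ shape)) mod-refl) (mod-* (mod-sym (proj₂ shape)) mod-refl))
                     (transfer (cong v₂ Aξ≡ξ) (ι-sum-of-products c x d y) mod-refl)

  allMats-unique : Unique allMats
  allMats-unique = Unique.cartesianProductWith⁺ _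
    (λ { {_ , _} {_ , _} {_ , _} {_ , _} refl → refl , refl }) allPairs-unique allPairs-unique
    where
    allPairs-unique : Unique allPairs
    allPairs-unique = Unique.cartesianProductWith⁺ _,_ (λ { refl → refl , refl }) (Unique.allFin⁺ q) (Unique.allFin⁺ q)

  Stab-unique : ∀ ξ → Unique (Stab ξ)
  Stab-unique ξ = Unique.filter⁺ (InStab? ξ) allMats-unique

  Stab-members : ∀ ξ → All (InStab ξ) (Stab ξ)
  Stab-members ξ = All.all-filter (InStab? ξ) allMats

module Counting where

  open import Data.Nat
  open import Data.Nat.Properties
  open import Data.List using (List; []; _∷_; length; filter; map)
  open import Data.List.Properties using (filter-all; filter-accept; filter-reject; length-map)
  open import Data.List.Relation.Unary.All as All using (All; []; _∷_)
  import Data.List.Relation.Unary.All.Properties as All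
  open import Data.List.Relation.Unary.AllPairs using ([]; _∷_)
  open import Data.List.Relation.Unary.Unique.Propositional using (Unique)
  import Data.List.Relation.Unary.Unique.Propositional.Properties as Unique
  open import Data.Product using (_,_)
  open import Relation.Nullary using (yes; no)
  open import Relation.Binary.PropositionalEquality

  -- In a duplicate-free list of numbers below N + 1, at most one entry is N,
  -- so discarding the entries ≥ N loses at most one element.
  drop-top-length : ∀ N (xs : List ℕ) → Unique xs → All (_< suc N) xs →
                    length xs ≤ suc (length (filter (_<? N) xs))
  drop-top-length N []       _           _          = z≤n
  drop-top-length N (x ∷ xs) (x∉xs ∷ u) (x≤N ∷ xs≤N) with x <? N
  ... | yes x<N rewrite filter-accept (_<? N) {xs = xs} x<N = s≤s (drop-top-length N xs u xs≤N)
  ... | no  x≮N rewrite filter-reject (_<? N) {xs = xs} x≮N =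
    s≤s (≤-reflexive (sym (cong length (filter-all (_<? N) rest<N))))
    where
    x≡N : x ≡ N
    x≡N = ≤-antisym (s≤s⁻¹ x≤N) (≮⇒≥ x≮N)
    rest<N : All (_< N) xs
    rest<N = All.zipWith (λ (y≤N , x≢y) → ≤∧≢⇒< (s≤s⁻¹ y≤N) (λ y≡N → x≢y (trans x≡N (sym y≡N))))
                         (xs≤N , x∉xs)

  unique-bounded-length : ∀ N (xs : List ℕ) → Unique xs → All (_< N) xs → length xs ≤ N
  unique-bounded-length zero    []      _ _          = z≤n
  unique-bounded-length zero    (_ ∷ _) _ (() ∷ _)
  unique-bounded-length (suc N) xs      u xs<1+N     = ≤-trans (drop-top-length N xs u xs<1+N)
    (s≤s (unique-bounded-length N (filter (_<? N) xs) (Unique.filter⁺ (_<? N) u) (All.all-filter (_<? N) xs)))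

  injection-bound : ∀ {A : Set} {P : A → Set} (f : A → ℕ) N →
    (∀ {x y} → P x → P y → f x ≡ f y → x ≡ y) →
    ∀ (xs : List A) → Unique xs → All P xs → All (λ x → f x < N) xs → length xs ≤ N
  injection-bound {P = P} f N f-injective xs u Pxs bounded =
    subst (_≤ N) (length-map f xs) (unique-bounded-length N (map f xs) (map-unique xs u Pxs) (All.map⁺ bounded))
    where
    map-unique : ∀ xs → Unique xs → All P xs → Unique (map f xs)
    map-unique []       []         []         = []
    map-unique (x ∷ xs) (x∉xs ∷ u) (px ∷ pxs) =
      All.map⁺ (All.zipWith (λ (py , x≢y) fx≡fy → x≢y (f-injective px py fx≡fy)) (pxs , x∉xs))
      ∷ map-unique xs u pxs

module PrimePower (p l : ℕ) (pr : Prime p) (p%4≡3 : p % 4 ≡ 3) where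

  open import Data.Nat as ℕ using (ℕ; _≤_; _^_; _∸_)
  import Data.Nat.Properties as ℕ
  import Data.Nat.Divisibility as ℕD
  open import Data.Nat.DivMod using (m*[n/m]≡n)
  open import Data.Nat.Primality using (prime⇒nonZero)
  open import Data.Fin using (toℕ)
  open import Data.Fin.Properties using (toℕ<n; toℕ-injective)
  open import Data.Integer using (ℤ; +_; _+_; _-_; _*_; 0ℤ; 1ℤ)
  open import Data.Integer.Properties using (+-comm)
  open import Data.Integer.Divisibility.Signed using (_∣_; _∣?_; ∣⇒∣ᵤ; ∣m∣n⇒∣m-n)
  open import Data.Integer.Tactic.RingSolver using (solve)
  open import Data.List using (_∷_; [])
  open import Data.Product using (_×_; _,_; proj₁; proj₂)
  open import Relation.Nullary using (¬_)
  open import Relation.Nullary.Decidable using (decidable-stable)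
  open import Relation.Binary.PropositionalEquality
  open Congruences
  open Rotations

  q : ℕ
  q = p ^ l

  instance
    p≢0 : ℕ.NonZero p
    p≢0 = prime⇒nonZero pr
    q≢0 : ℕ.NonZero q
    q≢0 = ℕ.m^n≢0 p l

  open ZMod q
  open Residues q

  -- A rotation fixing a nonzero vector of ℤ_q² is ≡ I (mod p): otherwise
  -- N = (a - 1)² + b² is prime to p and N·ξ ≡ 0 would force ξ ≡ 0; so p ∣ N,
  -- and since -1 is not a square mod p, p ∣ a - 1 and p ∣ b.
  fixing-nonzero-vector : ∀ {a₀ b₀ c d} {x y : Zq} → ¬ (x ≡ 0q × y ≡ 0q) →
    FixingRotation q a₀ b₀ c d (ι x) (ι y) → (+ p ∣ a₀ - 1ℤ) × (+ p ∣ b₀)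
  fixing-nonzero-vector {a₀} {b₀} ξ≢0 R =
    sum-of-two-squares pr p%4≡3 (a₀ - 1ℤ) b₀ p∣N ,
    sum-of-two-squares pr p%4≡3 b₀ (a₀ - 1ℤ) (divides-≡ p∣N (+-comm ((a₀ - 1ℤ) * (a₀ - 1ℤ)) (b₀ * b₀)))
    where
    N : ℤ
    N = (a₀ - 1ℤ) * (a₀ - 1ℤ) + b₀ * b₀
    vanishes : ∀ {z} → ¬ + p ∣ N → N * ι z ≈ 0ℤ mod q → z ≡ 0q
    vanishes p∤N Nz≈0 = ι-zero (prime-power-cancel pr p∤N l (≡0⇒divisible Nz≈0))
    p∣N : + p ∣ N
    p∣N = decidable-stable (+ p ∣? N) λ p∤N →
      ξ≢0 (vanishes p∤N (proj₁ (rotation-fixed-vector R)) , vanishes p∤N (proj₂ (rotation-fixed-vector R)))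

  -- If a₀ ≡ a₁ ≡ 1 (mod p) and a₀² + b₀² ≡ a₁² + b₀² ≡ 1 (mod q), then
  -- a₀ ≡ a₁ (mod q): q ∣ (a₀ + a₁)(a₀ - a₁) and a₀ + a₁ ≡ 2 is prime to p.
  norm-determines-near-one : ∀ {a₀ a₁ b₀} →
    a₀ * a₀ + b₀ * b₀ ≈ 1ℤ mod q → a₁ * a₁ + b₀ * b₀ ≈ 1ℤ mod q →
    + p ∣ a₀ - 1ℤ → + p ∣ a₁ - 1ℤ → a₀ ≈ a₁ mod q
  norm-determines-near-one {a₀} {a₁} {b₀} norm norm′ p∣a₀-1 p∣a₁-1 =
    congruent (prime-power-cancel pr p∤a₀+a₁ l q∣[a₀+a₁][a₀-a₁])
    where
    q∣[a₀+a₁][a₀-a₁] : + q ∣ (a₀ + a₁) * (a₀ - a₁)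
    q∣[a₀+a₁][a₀-a₁] = divides-≡ (∣m∣n⇒∣m-n (difference norm) (difference norm′)) (solve (a₀ ∷ a₁ ∷ b₀ ∷ []))
    p∤a₀+a₁ : ¬ + p ∣ a₀ + a₁
    p∤a₀+a₁ p∣a₀+a₁ = three-mod-four-∤2 p%4≡3
      (divides-≡ (∣m∣n⇒∣m-n (∣m∣n⇒∣m-n p∣a₀+a₁ p∣a₀-1) p∣a₁-1) (solve (a₀ ∷ a₁ ∷ [])))

  stabiliser-determined-by-b : ∀ {x y : Zq} → ¬ (x ≡ 0q × y ≡ 0q) → ∀ {A A′} →
    InStab (vec x y) A → InStab (vec x y) A′ → Mat.b A ≡ Mat.b A′ → A ≡ A′
  stabiliser-determined-by-b {x} {y} ξ≢0 {mat a₁ b₁ c₁ d₁} {mat a₂ .b₁ c₂ d₂} st st′ refl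
    = entries-equal (ι-injective a₁≈a₂) (ι-injective c₁≈c₂) (ι-injective d₁≈d₂)
    where
    entries-equal : a₁ ≡ a₂ → c₁ ≡ c₂ → d₁ ≡ d₂ → mat a₁ b₁ c₁ d₁ ≡ mat a₂ b₁ c₂ d₂
    entries-equal refl refl refl = refl
    R : FixingRotation q (ι a₁) (ι b₁) (ι c₁) (ι d₁) (ι x) (ι y)
    R = stabiliser-rotation st
    R′ : FixingRotation q (ι a₂) (ι b₁) (ι c₂) (ι d₂) (ι x) (ι y)
    R′ = stabiliser-rotation st′
    open FixingRotation
    a₁≈a₂ : ι a₁ ≈ ι a₂ mod q
    a₁≈a₂ = norm-determines-near-one {ι a₁} {ι a₂} {ι b₁} (norm R) (norm R′)
             (proj₁ (fixing-nonzero-vector ξ≢0 R)) (proj₁ (fixing-nonzero-vector ξ≢0 R′))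
    c₁≈c₂ : ι c₁ ≈ ι c₂ mod q
    c₁≈c₂ = mod-trans (c≈-b R) (mod-sym (c≈-b R′))
    d₁≈d₂ : ι d₁ ≈ ι d₂ mod q
    d₁≈d₂ = mod-trans (d≈a R) (mod-trans a₁≈a₂ (mod-sym (d≈a R′)))

  stabiliser-b-divisible : ∀ {x y : Zq} → ¬ (x ≡ 0q × y ≡ 0q) → ∀ {A} →
    InStab (vec x y) A → p ℕD.∣ toℕ (Mat.b A)
  stabiliser-b-divisible ξ≢0 {mat _ _ _ _} st =
    ∣⇒∣ᵤ (proj₂ (fixing-nonzero-vector ξ≢0 (stabiliser-rotation st)))

  index : Mat → ℕ
  index A = toℕ (Mat.b A) ℕ./ p

  index-bound : 1 ≤ l → ∀ A → p ℕD.∣ toℕ (Mat.b A) → index A ℕ.< p ^ (l ∸ 1)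
  index-bound l≥1 A p∣b = ℕ.*-cancelˡ-< p (index A) (p ^ (l ∸ 1)) (begin-strict
    p ℕ.* index A         ≡⟨ m*[n/m]≡n p∣b ⟩
    toℕ (Mat.b A)         <⟨ toℕ<n (Mat.b A) ⟩
    p ^ l                 ≡⟨ cong (p ^_) (ℕ.m+[n∸m]≡n l≥1) ⟨
    p ^ (1 ℕ.+ (l ∸ 1))   ∎)
    where open ℕ.≤-Reasoning

  index-injective : ∀ {A A′} → p ℕD.∣ toℕ (Mat.b A) → p ℕD.∣ toℕ (Mat.b A′) →
    index A ≡ index A′ → Mat.b A ≡ Mat.b A′
  index-injective {A} {A′} p∣b p∣b′ eq = toℕ-injective (begin
    toℕ (Mat.b A)      ≡⟨ m*[n/m]≡n p∣b ⟨
    p ℕ.* index A      ≡⟨ cong (p ℕ.*_) eq ⟩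
    p ℕ.* index A′     ≡⟨ m*[n/m]≡n p∣b′ ⟩
    toℕ (Mat.b A′)     ∎)
    where open ≡-Reasoning

  stabiliser-index-bound : 1 ≤ l → ∀ {ξ} → ¬ (v₁ ξ ≡ 0q × v₂ ξ ≡ 0q) →
    ∀ {A} → InStab ξ A → index A ℕ.< p ^ (l ∸ 1)
  stabiliser-index-bound l≥1 ξ≢0 {A} st = index-bound l≥1 A (stabiliser-b-divisible ξ≢0 st)

  stabiliser-index-injective : ∀ {ξ} → ¬ (v₁ ξ ≡ 0q × v₂ ξ ≡ 0q) →
    ∀ {A A′} → InStab ξ A → InStab ξ A′ → index A ≡ index A′ → A ≡ A′
  stabiliser-index-injective ξ≢0 {A} {A′} st st′ index≡ = stabiliser-determined-by-b ξ≢0 st st′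
    (index-injective {A} {A′} (stabiliser-b-divisible ξ≢0 st) (stabiliser-b-divisible ξ≢0 st′) index≡)

open import Data.Nat using (_≤_; _^_; _∸_)
open import Data.Nat.Properties using (m^n≢0)
open import Data.Nat.Primality using (prime⇒nonZero)
open import Data.Product using (_×_)
open import Relation.Nullary using (¬_)
import Data.List.Relation.Unary.All as All
open Counting using (injection-bound)

lemma2p2 : (p l : ℕ) → (pr : Prime p) → p % 4 ≡ 3 → 1 ≤ l →
    let open ZMod (p ^ l) {{m^n≢0 p l {{prime⇒nonZero pr}}}} in
    (ξ : Vec2) → ¬ (v₁ ξ ≡ 0q × v₂ ξ ≡ 0q) →
    v₁ ξ *q v₁ ξ +q v₂ ξ *q v₂ ξ ≡ 0q →
    ∣Stab∣ ξ ≤ p ^ (l ∸ 1)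
lemma2p2 p l pr p%4≡3 l≥1 ξ ξ≢0 _ =
  injection-bound index (p ^ (l ∸ 1)) (stabiliser-index-injective ξ≢0) (Stab ξ)
    (Stab-unique ξ) (Stab-members ξ) (All.map (stabiliser-index-bound l≥1 ξ≢0) (Stab-members ξ))
  where
  open PrimePower p l pr p%4≡3
  open ZMod (p ^ l) using (Stab)
  open Residues (p ^ l) using (Stab-unique; Stab-members)
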